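{- For each $m\ge 0$, there is an equality (natural isomorphism) of $\mathbb{L}$-species \[ \mathfrak{S}\times \mathcal{G}_m \;=\; \mathit{L}\circ(\mathit{L}^m)_+ . \] Equivalently, for every finite totally ordered set $\ell$ there is a bijection between pairs $(w,A)$, where $w$ is a permutation of $\ell$ and $A\in\mathcal{G}_m[\ell]$, and the $(\mathit{L}\circ(\mathit{L}^m)_+)$-structures on $\ell$.
   Context: An $\mathbb{L}$-species is a functor from finite totally ordered sets with order-preserving bijections to finite sets with bijections; since order-preserving bijections between totally ordered sets of equal size are unique, two $\mathbb{L}$-species $F,G$ are equal iff $|F[n]|=|G[n]|$ for all $n$ (where $[n]=\{1,\dots,n\}$ with its natural order). A linear order on a finite set $B$ is a word listing each element of $B$ exactly once; $\epsilon$ is the empty word. For a finite totally ordered set $\ell=\{u_1<\dots<u_n\}$, a $\mathcal{G}_m$-structure on $\ell$ is a matrix $A=[\mathbf a_1\cdots\mathbf a_k]$ with $m$ rows and some number $k\ge 0$ of columns, whose entries are linear orders of pairwise disjoint sets, such that (1) concatenating the entries of each column from top to bottom and then concatenating the columns from left to right gives the word $u_1u_2\cdots u_n$, and (2) every column contains at least one nonempty entry. $\mathfrak{S}$ is the species of permutations and $(\mathfrak{S}\times\mathcal{G}_m)[\ell]=\mathfrak{S}[\ell]\times\mathcal{G}_m[\ell]$. An $(\mathit{L}\circ(\mathit{L}^m)_+)$-structure on $\ell$ is a matrix with $m$ rows and some number of columns whose entries are linear orders of pairwise disjoint subsets of $\ell$ with union $\ell$, and in which every column has at least one nonempty entry (equivalently: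 a set partition of $\ell$, each block carrying an $m$-tuple of linear orders of disjoint sets covering the block, not all empty, the blocks being linearly ordered as columns). -}

module Defs where

open import Data.Bool using (Bool; true; false; T; not; _∧_; _∨_)
open import Data.Nat using (ℕ; _≡ᵇ_)
open import Data.Fin using (Fin; _≟_)
open import Data.Vec using (Vec; toList)
open import Data.List using (List; []; _∷_; concat; map; null; allFin; length; filter)
import Data.List.Properties as LP
open import Data.Product using (Σ)
open import Relation.Nullary.Decidable using (does)

allᵇ : ∀ {A : Set} → (A → Bool) → List A → Bool
allᵇ p []       = true
allᵇ p (x ∷ xs) = p x ∧ allᵇ p xs

anyᵇ : ∀ {A : Set} → (A → Bool) → List A → Bool
anyᵇ p []       = false
anyᵇ p (x ∷ xs) = p x ∨ anyᵇ p xs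

occ : ∀ {n} → Fin n → List (Fin n) → ℕ
occ x w = length (filter (x ≟_) w)

-- The totally ordered set ℓ = [n] is modelled as Fin n with its natural order.
-- A word over [n] is a List (Fin n).

isLinearOrderOfAll : (n : ℕ) → List (Fin n) → Bool
isLinearOrderOfAll n w = allᵇ (λ x → occ x w ≡ᵇ 1) (allFin n)

-- 𝔖[n] : permutations of [n], as linear orders (words) of [n].
Perm : ℕ → Set
Perm n = Σ (List (Fin n)) (λ w → T (isLinearOrderOfAll n w))

-- A matrix with m rows: a list of columns (left to right), each column a
-- vector of m entries (top to bottom), each entry a word.
Matrix : ℕ → ℕ → Set
Matrix m n = List (Vec (List (Fin n)) m)

readMatrix : ∀ {m n} → Matrix m n → List (Fin n)
readMatrix A = concat (map (λ col → concat (toList col)) A)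

columnsNonempty : ∀ {m n} → Matrix m n → Bool
columnsNonempty A = allᵇ (λ col → anyᵇ (λ e → not (null e)) (toList col)) A

_==w_ : ∀ {n} → List (Fin n) → List (Fin n) → Bool
u ==w v = does (LP.≡-dec _≟_ u v)

G : ℕ → ℕ → Set
G m n = Σ (Matrix m n) (λ A → T ((readMatrix A ==w allFin n) ∧ columnsNonempty A))

-- (L ∘ (L^m)_+)[n]: entries are linear orders of pairwise disjoint subsets of
-- [n] with union [n] (equivalently: the reading of the matrix lists every
-- element of [n] exactly once), and every column has a nonempty entry.
LcompLmPlus : ℕ → ℕ → Set
LcompLmPlus m n = Σ (Matrix m n) (λ A → T (isLinearOrderOfAll n (readMatrix A) ∧ columnsNonempty A))

-- A matrix of words is determined by its shape (the matrix of entry lengths) and its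
-- reading word, and any word of the right length can be poured into a given shape.
-- A 𝒢ₘ-structure on [n] is thus nothing but a shape of total size n with nonempty
-- columns, since its reading is forced to be 1 2 ⋯ n; an (L ∘ (Lᵐ)₊)-structure is
-- such a shape together with an arbitrary reading, i.e. a permutation of [n].
-- So (w , A) ↦ (shape of A filled with w) is a bijection.
module Submission where

open import Defs
open import Data.Nat using (ℕ)
open import Data.Product using (_×_)
open import Function.Bundles using (_↔_)

open import Algebra.Properties.CommutativeSemigroup using (interchange)
open import Data.Bool using (Bool; T; not; _∧_)
open import Data.Bool.Properties using (T-∧; T-irrelevant)
open import Data.Fin using (Fin; zero; suc; _≟_)
open import Data.List using (List; []; _∷_; _++_; [_]; concat; map; null; length; take; drop; allFin; tabulate)
import Data.List.Properties as List
open import Data.Nat using (_+_; _≤_; _≥_; _≡ᵇ_)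
open import Data.Nat.ListAction using (sum)
open import Data.Nat.Properties
  using (+-comm; +-commutativeSemigroup; ≤-reflexive; m+n≤o⇒m≤o; m+n≤o⇒m≤o∸n; m≤n⇒m⊓n≡m; ≡ᵇ⇒≡)
open import Data.Product using (Σ; _,_; proj₁; proj₂)
open import Data.Vec using (Vec; toList)
import Data.Vec as Vec
open import Data.Vec.Properties using (∷-injectiveʳ)
open import Function using (_∘_)
open import Function.Bundles using (Equivalence; mk↔ₛ′)
open import Relation.Nullary using (yes; no)
open import Relation.Binary.PropositionalEquality using (_≡_; refl; sym; trans; cong; cong₂; subst; module ≡-Reasoning)
open ≡-Reasoning

open Equivalence using (to; from)

private
  variable
    X Y : Set
    m n : ℕ

Σ-T-≡ : {P : X → Bool} {x y : Σ X (T ∘ P)} → proj₁ x ≡ proj₁ y → x ≡ y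
Σ-T-≡ {x = a , _} {.a , _} refl = cong (a ,_) (T-irrelevant _ _)

==w⇒≡ : {u v : List (Fin n)} → T (u ==w v) → u ≡ v
==w⇒≡ {u = u} {v} t with List.≡-dec _≟_ u v
... | yes u≡v = u≡v

==w-refl : (u : List (Fin n)) → T (u ==w u)
==w-refl u with List.≡-dec _≟_ u u
... | yes _   = _
... | no u≢u = u≢u refl

take-length-++ : (u v : List X) → take (length u) (u ++ v) ≡ u
take-length-++ []      v = refl
take-length-++ (x ∷ u) v = cong (x ∷_) (take-length-++ u v)

drop-length-++ : (u v : List X) → drop (length u) (u ++ v) ≡ v
drop-length-++ []      v = refl
drop-length-++ (x ∷ u) v = drop-length-++ u v

length-take-≤ : (k : ℕ) (w : List X) → k ≤ length w → length (take k w) ≡ k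
length-take-≤ k w k≤ = trans (List.length-take k w) (m≤n⇒m⊓n≡m k≤)

≤-length-drop : (k s : ℕ) (w : List X) → k + s ≤ length w → s ≤ length (drop k w)
≤-length-drop k s w k+s≤ =
  subst (s ≤_) (sym (List.length-drop k w)) (m+n≤o⇒m≤o∸n s (subst (_≤ length w) (+-comm k s) k+s≤))

-- u ++ drop a w ≡ w says that u is the prefix of length a of w.
++-drop-+ : (u v w : List X) (a b : ℕ) →
            u ++ drop a w ≡ w → v ++ drop b (drop a w) ≡ drop a w → (u ++ v) ++ drop (a + b) w ≡ w
++-drop-+ u v w a b u-prefix v-prefix = begin
  (u ++ v) ++ drop (a + b) w          ≡⟨ List.++-assoc u v _ ⟩
  u ++ (v ++ drop (a + b) w)          ≡⟨ cong (λ r → u ++ (v ++ r)) (List.drop-drop a b w) ⟨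
  u ++ (v ++ drop b (drop a w))       ≡⟨ cong (u ++_) v-prefix ⟩
  u ++ drop a w                       ≡⟨ u-prefix ⟩
  w                                   ∎

readColumn : Vec (List X) m → List X
readColumn c = concat (toList c)

columnShape : Vec (List X) m → Vec ℕ m
columnShape = Vec.map length

fillColumn : Vec ℕ m → List Y → Vec (List Y) m
fillColumn Vec.[]       w = Vec.[]
fillColumn (k Vec.∷ ks) w = take k w Vec.∷ fillColumn ks (drop k w)

length-readColumn : (c : Vec (List X) m) → length (readColumn c) ≡ Vec.sum (columnShape c)
length-readColumn Vec.[]      = refl
length-readColumn (e Vec.∷ c) = trans (List.length-++ e) (cong (length e +_) (length-readColumn c))

drop-columnSize : (c : Vec (List X) m) (r : List X) → drop (Vec.sum (columnShape c)) (readColumn c ++ r) ≡ r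
drop-columnSize c r =
  subst (λ k → drop k (readColumn c ++ r) ≡ r) (length-readColumn c) (drop-length-++ (readColumn c) r)

readColumn-fillColumn : (ks : Vec ℕ m) (w : List Y) → readColumn (fillColumn ks w) ++ drop (Vec.sum ks) w ≡ w
readColumn-fillColumn Vec.[]       w = refl
readColumn-fillColumn (k Vec.∷ ks) w =
  ++-drop-+ (take k w) _ w k (Vec.sum ks) (List.take++drop≡id k w) (readColumn-fillColumn ks (drop k w))

fillColumn-columnShape : (c : Vec (List X) m) (r : List X) → fillColumn (columnShape c) (readColumn c ++ r) ≡ c
fillColumn-columnShape Vec.[]      r = refl
fillColumn-columnShape (e Vec.∷ c) r
  rewrite List.++-assoc e (readColumn c) r
        | take-length-++ e (readColumn c ++ r)
        | drop-length-++ e (readColumn c ++ r)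
  = cong (e Vec.∷_) (fillColumn-columnShape c r)

columnShape-fillColumn : (ks : Vec ℕ m) (w : List Y) → Vec.sum ks ≤ length w → columnShape (fillColumn ks w) ≡ ks
columnShape-fillColumn Vec.[]       w _  = refl
columnShape-fillColumn (k Vec.∷ ks) w ≤w =
  cong₂ Vec._∷_ (length-take-≤ k w (m+n≤o⇒m≤o k ≤w))
                (columnShape-fillColumn ks (drop k w) (≤-length-drop k (Vec.sum ks) w ≤w))

reading : List (Vec (List X) m) → List X
reading A = concat (map readColumn A)

shape : List (Vec (List X) m) → List (Vec ℕ m)
shape = map columnShape

size : List (Vec ℕ m) → ℕ
size s = sum (map Vec.sum s)

fill : List (Vec ℕ m) → List Y → List (Vec (List Y) m)
fill []      w = []
fill (c ∷ s) w = fillColumn c w ∷ fill s (drop (Vec.sum c) w)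

length-reading : (A : List (Vec (List X) m)) → length (reading A) ≡ size (shape A)
length-reading []      = refl
length-reading (c ∷ A) = begin
  length (readColumn c ++ reading A)            ≡⟨ List.length-++ (readColumn c) ⟩
  length (readColumn c) + length (reading A)    ≡⟨ cong₂ _+_ (length-readColumn c) (length-reading A) ⟩
  Vec.sum (columnShape c) + size (shape A)      ∎

reading-fill : (s : List (Vec ℕ m)) (w : List Y) → reading (fill s w) ++ drop (size s) w ≡ w
reading-fill []      w = refl
reading-fill (c ∷ s) w =
  ++-drop-+ (readColumn (fillColumn c w)) _ w (Vec.sum c) (size s)
            (readColumn-fillColumn c w) (reading-fill s (drop (Vec.sum c) w))

fill-shape : (A : List (Vec (List X) m)) (r : List X) → fill (shape A) (reading A ++ r) ≡ A
fill-shape []      r = refl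
fill-shape (c ∷ A) r
  rewrite List.++-assoc (readColumn c) (reading A) r
        | drop-columnSize c (reading A ++ r)
  = cong₂ _∷_ (fillColumn-columnShape c (reading A ++ r)) (fill-shape A r)

shape-fill : (s : List (Vec ℕ m)) (w : List Y) → size s ≤ length w → shape (fill s w) ≡ s
shape-fill []      w _  = refl
shape-fill (c ∷ s) w ≤w =
  cong₂ _∷_ (columnShape-fillColumn c w (m+n≤o⇒m≤o (Vec.sum c) ≤w))
            (shape-fill s (drop (Vec.sum c) w) (≤-length-drop (Vec.sum c) (size s) w ≤w))

reshape : List (Vec (List X) m) → List Y → List (Vec (List Y) m)
reshape A = fill (shape A)

reading-reshape : (A : List (Vec (List X) m)) (w : List Y) → length w ≡ length (reading A) →
                  reading (reshape A w) ≡ w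
reading-reshape A w w≡A = begin
  reading (reshape A w)                            ≡⟨ List.++-identityʳ _ ⟨
  reading (reshape A w) ++ []                      ≡⟨ cong (reading (reshape A w) ++_) (List.drop-all _ w size≥w) ⟨
  reading (reshape A w) ++ drop (size (shape A)) w ≡⟨ reading-fill (shape A) w ⟩
  w                                                ∎
  where
  size≥w : size (shape A) ≥ length w
  size≥w = ≤-reflexive (trans w≡A (length-reading A))

shape-reshape : (A : List (Vec (List X) m)) (w : List Y) → length w ≡ length (reading A) →
                shape (reshape A w) ≡ shape A
shape-reshape A w w≡A = shape-fill (shape A) w (≤-reflexive (sym (trans w≡A (length-reading A))))

reshape-reading : (A : List (Vec (List X) m)) → reshape A (reading A) ≡ A
reshape-reading A = trans (cong (fill (shape A)) (sym (List.++-identityʳ (reading A)))) (fill-shape A [])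

reshape-reshape : (A : List (Vec (List X) m)) (w : List Y) (v : List X) → length w ≡ length (reading A) →
                  reshape (reshape A w) v ≡ reshape A v
reshape-reshape A w v w≡A = cong (λ s → fill s v) (shape-reshape A w w≡A)

hasNonemptyEntry-cong : (c : Vec (List X) m) (d : Vec (List Y) m) → columnShape c ≡ columnShape d →
                        anyᵇ (λ e → not (null e)) (toList c)
                          ≡ anyᵇ (λ e → not (null e)) (toList d)
hasNonemptyEntry-cong Vec.[]             Vec.[]             _  = refl
hasNonemptyEntry-cong ([] Vec.∷ c)      ([] Vec.∷ d)      eq = hasNonemptyEntry-cong c d (∷-injectiveʳ eq)
hasNonemptyEntry-cong ((_ ∷ _) Vec.∷ _) ((_ ∷ _) Vec.∷ _) _  = refl

columnsNonempty-cong : (A B : Matrix m n) → shape A ≡ shape B → columnsNonempty A ≡ columnsNonempty B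
columnsNonempty-cong []      []      _  = refl
columnsNonempty-cong (c ∷ A) (d ∷ B) eq =
  cong₂ _∧_ (hasNonemptyEntry-cong c d (List.∷-injectiveˡ eq)) (columnsNonempty-cong A B (List.∷-injectiveʳ eq))

columnsNonempty-reshape : (A : Matrix m n) (w : List (Fin n)) → length w ≡ length (reading A) →
                          columnsNonempty (reshape A w) ≡ columnsNonempty A
columnsNonempty-reshape A w w≡A = columnsNonempty-cong (reshape A w) A (shape-reshape A w w≡A)

length-allFin : (n : ℕ) → length (allFin n) ≡ n
length-allFin n = List.length-tabulate (λ x → x)

sum-map-+ : (f g : X → ℕ) (xs : List X) → sum (map (λ x → f x + g x) xs) ≡ sum (map f xs) + sum (map g xs)
sum-map-+ f g []       = refl
sum-map-+ f g (x ∷ xs) =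
  trans (cong (f x + g x +_) (sum-map-+ f g xs)) (interchange +-commutativeSemigroup (f x) (g x) _ _)

occ-∷ : (x y : Fin n) (w : List (Fin n)) → occ x (y ∷ w) ≡ occ x [ y ] + occ x w
occ-∷ x y w with x ≟ y
... | yes _ = refl
... | no _  = refl

sum-tabulate-zero : (n : ℕ) → sum (tabulate (λ (_ : Fin n) → 0)) ≡ 0
sum-tabulate-zero ℕ.zero    = refl
sum-tabulate-zero (ℕ.suc n) = sum-tabulate-zero n

-- Not definitional: the two filtered lists keep different elements.
occ-suc-singleton : (x y : Fin n) → occ (suc x) [ suc y ] ≡ occ x [ y ]
occ-suc-singleton x y with x ≟ y
... | yes _ = refl
... | no _  = refl

sum-tabulate-occ-singleton : (y : Fin n) → sum (tabulate (λ x → occ x [ y ])) ≡ 1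
sum-tabulate-occ-singleton {ℕ.suc n} zero    = cong ℕ.suc (sum-tabulate-zero n)
sum-tabulate-occ-singleton {ℕ.suc n} (suc y) =
  trans (cong sum (List.tabulate-cong (λ x → occ-suc-singleton x y))) (sum-tabulate-occ-singleton y)

sum-occ : (w : List (Fin n)) → sum (map (λ x → occ x w) (allFin n)) ≡ length w
sum-occ {n} [] = trans (cong sum (List.map-tabulate {n = n} (λ x → x) (λ x → occ x []))) (sum-tabulate-zero n)
sum-occ {n} (y ∷ w) = begin
  sum (map (λ x → occ x (y ∷ w)) (allFin n))
    ≡⟨ cong sum (List.map-cong (λ x → occ-∷ x y w) (allFin n)) ⟩
  sum (map (λ x → occ x [ y ] + occ x w) (allFin n))
    ≡⟨ sum-map-+ (λ x → occ x [ y ]) (λ x → occ x w) (allFin n) ⟩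
  sum (map (λ x → occ x [ y ]) (allFin n)) + sum (map (λ x → occ x w) (allFin n))
    ≡⟨ cong₂ _+_ sum-occ-y (sum-occ w) ⟩
  1 + length w
    ∎
  where
  sum-occ-y : sum (map (λ x → occ x [ y ]) (allFin n)) ≡ 1
  sum-occ-y = trans (cong sum (List.map-tabulate (λ x → x) (λ x → occ x [ y ]))) (sum-tabulate-occ-singleton y)

sum-map-allᵇ-≡ᵇ1 : (f : X → ℕ) (xs : List X) → T (allᵇ (λ x → f x ≡ᵇ 1) xs) → sum (map f xs) ≡ length xs
sum-map-allᵇ-≡ᵇ1 f []       _ = refl
sum-map-allᵇ-≡ᵇ1 f (x ∷ xs) t =
  cong₂ _+_ (≡ᵇ⇒≡ (f x) 1 (proj₁ (T-∧ .to t))) (sum-map-allᵇ-≡ᵇ1 f xs (proj₂ (T-∧ .to t)))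

length-linearOrder : (w : List (Fin n)) → T (isLinearOrderOfAll n w) → length w ≡ n
length-linearOrder {n} w lin = begin
  length w                                      ≡⟨ sum-occ w ⟨
  sum (map (λ x → occ x w) (allFin n))          ≡⟨ sum-map-allᵇ-≡ᵇ1 (λ x → occ x w) (allFin n) lin ⟩
  length (allFin n)                             ≡⟨ length-allFin n ⟩
  n                                             ∎

reading-G : (A : G m n) → readMatrix (proj₁ A) ≡ allFin n
reading-G {n = n} (A , A-G) = ==w⇒≡ (proj₁ (T-∧ {readMatrix A ==w allFin n} .to A-G))

nonempty-G : (A : G m n) → T (columnsNonempty (proj₁ A))
nonempty-G {n = n} (A , A-G) = proj₂ (T-∧ {readMatrix A ==w allFin n} .to A-G)

linear-L : (B : LcompLmPlus m n) → T (isLinearOrderOfAll n (readMatrix (proj₁ B)))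
linear-L {n = n} (B , B-L) = proj₁ (T-∧ {isLinearOrderOfAll n (readMatrix B)} .to B-L)

nonempty-L : (B : LcompLmPlus m n) → T (columnsNonempty (proj₁ B))
nonempty-L {n = n} (B , B-L) = proj₂ (T-∧ {isLinearOrderOfAll n (readMatrix B)} .to B-L)

length-Perm : (w : Perm n) → length (proj₁ w) ≡ n
length-Perm (w , w-lin) = length-linearOrder w w-lin

length-reading-G : (A : G m n) → length (readMatrix (proj₁ A)) ≡ n
length-reading-G {n = n} A = trans (cong length (reading-G A)) (length-allFin n)

length-reading-L : (B : LcompLmPlus m n) → length (readMatrix (proj₁ B)) ≡ n
length-reading-L B = length-linearOrder (readMatrix (proj₁ B)) (linear-L B)

module _ {m n : ℕ} where

  fillWithPermutation : Perm n × G m n → LcompLmPlus m n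
  fillWithPermutation (𝓌@(w , _) , 𝒜@(A , _)) = reshape A w , T-∧ .from (linear , nonempty)
    where
    fits : length w ≡ length (reading A)
    fits = trans (length-Perm 𝓌) (sym (length-reading-G 𝒜))
    linear : T (isLinearOrderOfAll n (readMatrix (reshape A w)))
    linear = subst (T ∘ isLinearOrderOfAll n) (sym (reading-reshape A w fits)) (proj₂ 𝓌)
    nonempty : T (columnsNonempty (reshape A w))
    nonempty = subst T (sym (columnsNonempty-reshape A w fits)) (nonempty-G 𝒜)

  splitReading : LcompLmPlus m n → Perm n × G m n
  splitReading ℬ@(B , _) = (reading B , linear-L ℬ) , (reshape B (allFin n) , T-∧ .from (reads , nonempty))
    where
    fits : length (allFin n) ≡ length (reading B)
    fits = trans (length-allFin n) (sym (length-reading-L ℬ))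
    reads : T (readMatrix (reshape B (allFin n)) ==w allFin n)
    reads = subst (λ u → T (u ==w allFin n)) (sym (reading-reshape B (allFin n) fits)) (==w-refl (allFin n))
    nonempty : T (columnsNonempty (reshape B (allFin n)))
    nonempty = subst T (sym (columnsNonempty-reshape B (allFin n) fits)) (nonempty-L ℬ)

lemma4p3 : (m n : ℕ) → (Perm n × G m n) ↔ LcompLmPlus m n
lemma4p3 m n = mk↔ₛ′ fillWithPermutation splitReading fill-split split-fill
  where
  fill-split : (B : LcompLmPlus m n) → fillWithPermutation (splitReading B) ≡ B
  fill-split ℬ@(B , _) = Σ-T-≡ (begin
    reshape (reshape B (allFin n)) (reading B)   ≡⟨ reshape-reshape B (allFin n) (reading B) fits ⟩
    reshape B (reading B)                         ≡⟨ reshape-reading B ⟩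
    B                                             ∎)
    where
    fits : length (allFin n) ≡ length (reading B)
    fits = trans (length-allFin n) (sym (length-reading-L ℬ))

  split-fill : (wA : Perm n × G m n) → splitReading (fillWithPermutation wA) ≡ wA
  split-fill (𝓌@(w , _) , 𝒜@(A , _)) = cong₂ _,_ (Σ-T-≡ (reading-reshape A w fits)) (Σ-T-≡ (begin
    reshape (reshape A w) (allFin n)   ≡⟨ reshape-reshape A w (allFin n) fits ⟩
    reshape A (allFin n)               ≡⟨ cong (reshape A) (reading-G 𝒜) ⟨
    reshape A (reading A)              ≡⟨ reshape-reading A ⟩
    A                                  ∎))
    where
    fits : length w ≡ length (reading A)
    fits = trans (length-Perm 𝓌) (sym (length-reading-G 𝒜))
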